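{- Let $G=(V,E)$ be a directed graph with $\sim_{dnd}$-equivalence classes $C_1,\dots,C_{\mathsf{dnd}(G)}$. For any induced directed path $p=v_1,\dots,v_\ell$ in $G$, there is at most one $i\in\{1,\dots,\mathsf{dnd}(G)\}$ with $|C_i\cap p|>1$, and for such an $i$ we have $C_i\cap p=\{v_1,v_\ell\}$.
   Context: A directed path $v_1,\dots,v_\ell$ consists of distinct vertices with $(v_i,v_{i+1})\in E$; it is induced if the subgraph induced by its vertex set is exactly this path. Let $N^-(v)=\{x:(x,v)\in E\}$, $N^+(v)=\{x:(v,x)\in E\}$. Define $v\sim_{dnd}u$ if $N^-(v)\setminus\{u\}=N^-(u)\setminus\{v\}$, $N^+(v)\setminus\{u\}=N^+(u)\setminus\{v\}$, and $(v,u)\in E\Leftrightarrow (u,v)\in E$. This is an equivalence relation; $\mathsf{dnd}(G)$ is its number of classes. -}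

module Defs where

open import Level using (Level)
open import Data.Nat using (ℕ; suc)
import Data.Fin as Fin
open import Data.Fin using (Fin; zero; toℕ; fromℕ; inject₁)
open import Data.Product using (Σ; ∃; _×_; _,_)
open import Data.Sum using (_⊎_)
open import Relation.Binary.PropositionalEquality using (_≡_; _≢_)
open import Relation.Nullary using (¬_)
open import Function.Definitions using (Injective)
open import Function.Bundles using (_⇔_)

record Digraph (ℓ : Level) : Set (Level.suc ℓ) where
  field
    n      : ℕ
    E      : Fin n → Fin n → Set ℓ
    noLoop : ∀ x → ¬ E x x

module _ {ℓ : Level} (G : Digraph ℓ) where
  open Digraph G

  _∼dnd_ : Fin n → Fin n → Set ℓ
  v ∼dnd u =
    (∀ x → (E x v × x ≢ u) ⇔ (E x u × x ≢ v)) ×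
    (∀ x → (E v x × x ≢ u) ⇔ (E u x × x ≢ v)) ×
    (E v u ⇔ E u v)

  -- A directed path v₁,…,v_{m+1} (ℓ = m+1 ≥ 1 vertices), as a map from
  -- positions Fin (suc m) to vertices.
  record IsDirPath {m : ℕ} (p : Fin (suc m) → Fin n) : Set ℓ where
    field
      distinct : Injective _≡_ _≡_ p
      step     : ∀ (i : Fin m) → E (p (inject₁ i)) (p (Fin.suc i))

  record IsInducedDirPath {m : ℕ} (p : Fin (suc m) → Fin n) : Set ℓ where
    field
      isPath  : IsDirPath p
      induced : ∀ (i j : Fin (suc m)) → E (p i) (p j) → toℕ j ≡ suc (toℕ i)

  _∈Path_ : {m : ℕ} → Fin n → (Fin (suc m) → Fin n) → Set
  x ∈Path p = ∃ λ k → p k ≡ x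

  -- The ∼dnd-class of a (i.e. {x | x ∼dnd a}) meets p in more than one vertex.
  ClassMeetsTwice : {m : ℕ} → Fin n → (Fin (suc m) → Fin n) → Set ℓ
  ClassMeetsTwice a p =
    Σ (Fin n) λ x → Σ (Fin n) λ y →
      x ≢ y × x ∈Path p × y ∈Path p × x ∼dnd a × y ∼dnd a

-- On an induced path, if a vertex v other than the first is ∼dnd-equivalent
-- to a later path vertex u, then the predecessor of v is also an in-neighbour
-- of u, which is a chord; dually for a vertex other than the last and an
-- earlier u.
-- So two distinct ∼dnd-equivalent path vertices must be the two endpoints,
-- and every class meeting the path twice contains both endpoints.
module Submission where

open import Defs
open import Data.Nat using (ℕ; suc)
import Data.Nat as ℕ
open import Data.Nat.Properties using (<-trans; n<1+n; <⇒≢; suc-injective)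
import Data.Fin as Fin
open import Data.Fin using (Fin; zero; fromℕ; toℕ; inject₁; lower₁; _<_; _≟_)
open import Data.Fin.Properties
  using (toℕ-injective; toℕ-inject₁; toℕ-fromℕ; toℕ-lower₁; inject₁-lower₁; <-cmp)
open import Data.Product using (_×_; _,_; proj₁; proj₂)
open import Data.Sum using (_⊎_; inj₁; inj₂)
open import Function using (flip; _∘_)
open import Function.Bundles using (_⇔_; mk⇔; Equivalence)
import Function.Properties.Equivalence as ⇔
open import Level using (Level)
open import Relation.Binary using (tri<; tri≈; tri>)
open import Relation.Binary.PropositionalEquality
  using (_≡_; _≢_; refl; sym; trans; cong; subst)
open import Relation.Nullary using (yes; no; contradiction)

open Equivalence

private
  variable
    ℓ : Level

reverse : Digraph ℓ → Digraph ℓ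
reverse G = record { n = n ; E = flip E ; noLoop = noLoop }
  where open Digraph G

module _ (G : Digraph ℓ) where
  open Digraph G

  private
    infix 4 _∼_
    _∼_ : Fin n → Fin n → Set ℓ
    _∼_ = _∼dnd_ G

  ∼dnd-sym : ∀ {v u} → v ∼ u → u ∼ v
  ∼dnd-sym (ins , outs , edge) =
    (λ x → ⇔.sym (ins x)) , (λ x → ⇔.sym (outs x)) , ⇔.sym edge

  ∼dnd-reverse : ∀ {v u} → v ∼ u → _∼dnd_ (reverse G) v u
  ∼dnd-reverse (ins , outs , edge) = outs , ins , ⇔.sym edge

  ∼dnd-trans-in : ∀ {v u w} → v ∼ u → u ∼ w →
                      ∀ x → E x v × x ≢ w → E x w × x ≢ v
  ∼dnd-trans-in {v} {u} {w} (ins₁ , outs₁ , edge₁) (ins₂ , _ , _) x (xv , x≢w)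
    with x ≟ u
  ... | no x≢u =
    let xu , x≢v = to (ins₁ x) (xv , x≢u) in proj₁ (to (ins₂ x) (xu , x≢w)) , x≢v
  ... | yes refl = xw , λ { refl → noLoop x xv }
    where
      xw : E x w
      xw with v ≟ w
      ... | yes refl = xv
      ... | no v≢w =
        proj₁ (to (outs₁ w) (proj₁ (to (ins₂ v) (from edge₁ xv , v≢w)) , x≢w ∘ sym))

  ∼dnd-trans-edge : ∀ {v u w} → v ∼ u → u ∼ w → E v w → E w v
  ∼dnd-trans-edge {v} {u} {w} (ins₁ , outs₁ , edge₁) (_ , _ , edge₂) vw with w ≟ u
  ... | yes refl = to edge₁ vw
  ... | no w≢u =
    let uw , w≢v = to (outs₁ w) (vw , w≢u) in proj₁ (from (ins₁ w) (to edge₂ uw , w≢v))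

∼dnd-trans : (G : Digraph ℓ) → ∀ {v u w} → _∼dnd_ G v u → _∼dnd_ G u w → _∼dnd_ G v w
-- The out-neighbour condition is the in-neighbour condition of the reversed graph.
∼dnd-trans G vu uw =
  (λ x → mk⇔ (∼dnd-trans-in G vu uw x) (∼dnd-trans-in G (sym′ uw) (sym′ vu) x)) ,
  (λ x → mk⇔ (∼dnd-trans-in Gᵒᵖ (rev vu) (rev uw) x)
             (∼dnd-trans-in Gᵒᵖ (rev (sym′ uw)) (rev (sym′ vu)) x)) ,
  mk⇔ (∼dnd-trans-edge G vu uw) (∼dnd-trans-edge G (sym′ uw) (sym′ vu))
  where
    Gᵒᵖ : Digraph _
    Gᵒᵖ = reverse G

    sym′ : ∀ {x y} → _∼dnd_ G x y → _∼dnd_ G y x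
    sym′ = ∼dnd-sym G

    rev : ∀ {x y} → _∼dnd_ G x y → _∼dnd_ Gᵒᵖ x y
    rev = ∼dnd-reverse G

module _ (G : Digraph ℓ) {m : ℕ} {p : Fin (suc m) → Fin (Digraph.n G)}
         (induced-path : IsInducedDirPath G p) where
  open Digraph G
  open IsInducedDirPath induced-path
  open IsDirPath isPath

  private
    infix 4 _∼_
    _∼_ : Fin n → Fin n → Set ℓ
    _∼_ = _∼dnd_ G

  IsEndpoint : Fin n → Set
  IsEndpoint x = x ≡ p zero ⊎ x ≡ p (fromℕ m)

  path-≢ : ∀ {i j} → toℕ i ≢ toℕ j → p i ≢ p j
  path-≢ i≢j pi≡pj = i≢j (cong toℕ (distinct pi≡pj))

  ∼dnd-later⇒first : ∀ {i j} → p i ∼ p j → i < j → i ≡ zero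
  ∼dnd-later⇒first {zero} _ _ = refl
  ∼dnd-later⇒first {Fin.suc q} {j} (ins , _ , _) i<j = contradiction chord (<⇒≢ i<j ∘ sym)
    where
      q<j : toℕ (inject₁ q) ℕ.< toℕ j
      q<j = subst (ℕ._< toℕ j) (sym (toℕ-inject₁ q)) (<-trans (n<1+n (toℕ q)) i<j)

      chord : toℕ j ≡ suc (toℕ q)
      chord = trans (induced (inject₁ q) j
                       (proj₁ (to (ins _) (step q , path-≢ (<⇒≢ q<j)))))
                    (cong suc (toℕ-inject₁ q))

  ∼dnd-earlier⇒last : ∀ {i j} → p i ∼ p j → i < j → toℕ j ≡ m
  ∼dnd-earlier⇒last {i} {j} (_ , outs , _) i<j with m ℕ.≟ toℕ j
  ... | yes m≡j = sym m≡j
  ... | no m≢j = contradiction chord (<⇒≢ i<j ∘ sym)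
    where
      j′ : Fin m
      j′ = lower₁ j m≢j

      successor : Fin (suc m)
      successor = Fin.suc j′

      toℕ-successor : toℕ successor ≡ suc (toℕ j)
      toℕ-successor = cong suc (toℕ-lower₁ j m≢j)

      j→successor : E (p j) (p successor)
      j→successor = subst (λ k → E (p k) (p successor)) (inject₁-lower₁ j m≢j) (step j′)

      i<successor : toℕ i ℕ.< toℕ successor
      i<successor = subst (toℕ i ℕ.<_) (sym toℕ-successor) (<-trans i<j (n<1+n (toℕ j)))

      chord : toℕ j ≡ toℕ i
      chord = suc-injective (trans (sym toℕ-successor)
                (induced i successor
                  (proj₁ (from (outs _) (j→successor , path-≢ (<⇒≢ i<successor ∘ sym))))))

  ∼dnd-distinct⇒endpoint : ∀ {i j} → i ≢ j → p i ∼ p j → IsEndpoint (p i)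
  ∼dnd-distinct⇒endpoint {i} {j} i≢j pi∼pj with <-cmp i j
  ... | tri< i<j _ _ = inj₁ (cong p (∼dnd-later⇒first pi∼pj i<j))
  ... | tri≈ _ i≡j _ = contradiction i≡j i≢j
  ... | tri> _ _ j<i = inj₂ (cong p (toℕ-injective
          (trans (∼dnd-earlier⇒last (∼dnd-sym G pi∼pj) j<i) (sym (toℕ-fromℕ m)))))

  ∼dnd-on-path⇒endpoint : ∀ {x y} → x ≢ y → _∈Path_ G x p → _∈Path_ G y p → x ∼ y →
                          IsEndpoint x
  ∼dnd-on-path⇒endpoint x≢y (i , refl) (j , refl) =
    ∼dnd-distinct⇒endpoint (x≢y ∘ cong p)

  -- x differs from at least one of the two witnesses y ≢ z in the class of a.
  class-member⇒endpoint : ∀ {a x} → ClassMeetsTwice G a p → x ∼ a → _∈Path_ G x p →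
                          IsEndpoint x
  class-member⇒endpoint {x = x} (y , z , y≢z , y∈p , z∈p , y∼a , z∼a) x∼a x∈p with x ≟ y
  ... | yes refl = ∼dnd-on-path⇒endpoint y≢z x∈p z∈p (∼dnd-trans G x∼a (∼dnd-sym G z∼a))
  ... | no x≢y   = ∼dnd-on-path⇒endpoint x≢y x∈p y∈p (∼dnd-trans G x∼a (∼dnd-sym G y∼a))

  class-meets-twice⇒endpoints : ∀ {a} → ClassMeetsTwice G a p →
                                p zero ∼ a × p (fromℕ m) ∼ a
  class-meets-twice⇒endpoints meets@(y , z , y≢z , y∈p , z∈p , y∼a , z∼a)
    with class-member⇒endpoint meets y∼a y∈p | class-member⇒endpoint meets z∼a z∈p
  ... | inj₁ refl | inj₂ refl = y∼a , z∼a
  ... | inj₂ refl | inj₁ refl = z∼a , y∼a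
  ... | inj₁ refl | inj₁ refl = contradiction refl y≢z
  ... | inj₂ refl | inj₂ refl = contradiction refl y≢z

lemma5 : {ℓ : Level} (G : Digraph ℓ) {m : ℕ} (p : Fin (suc m) → Fin (Digraph.n G)) →
    IsInducedDirPath G p →
    ((a b : Fin (Digraph.n G)) → ClassMeetsTwice G a p → ClassMeetsTwice G b p →
      _∼dnd_ G a b)
    ×
    ((a : Fin (Digraph.n G)) → ClassMeetsTwice G a p →
      (x : Fin (Digraph.n G)) →
        (_∼dnd_ G x a × _∈Path_ G x p) ⇔ (x ≡ p zero ⊎ x ≡ p (fromℕ m)))
lemma5 G {m} p induced-path = same-class , class-on-path
  where
    endpoints : ∀ {a} → ClassMeetsTwice G a p → _∼dnd_ G (p zero) a × _∼dnd_ G (p (fromℕ m)) a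
    endpoints = class-meets-twice⇒endpoints G induced-path

    same-class : ∀ a b → ClassMeetsTwice G a p → ClassMeetsTwice G b p → _∼dnd_ G a b
    same-class a b a-twice b-twice =
      ∼dnd-trans G (∼dnd-sym G (proj₁ (endpoints a-twice))) (proj₁ (endpoints b-twice))

    class-on-path : ∀ a → ClassMeetsTwice G a p → ∀ x →
                    (_∼dnd_ G x a × _∈Path_ G x p) ⇔ (x ≡ p zero ⊎ x ≡ p (fromℕ m))
    class-on-path a a-twice x = mk⇔
      (λ (x∼a , x∈p) → class-member⇒endpoint G induced-path a-twice x∼a x∈p)
      λ { (inj₁ refl) → proj₁ (endpoints a-twice) , zero , refl
        ; (inj₂ refl) → proj₂ (endpoints a-twice) , fromℕ m , refl }
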